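{- $(\mathbf{T}^{\mathcal D}_{CK},\curlyvee,\rhd)$ is a commutative prelie algebra, i.e. for all $x,y,z\in\mathbf{T}^{\mathcal D}_{CK}$: $x\curlyvee y=y\curlyvee x$, $(x\curlyvee y)\curlyvee z=x\curlyvee(y\curlyvee z)$, $x\rhd(y\rhd z)-(x\rhd y)\rhd z=y\rhd(x\rhd z)-(y\rhd x)\rhd z$, and $x\rhd(y\curlyvee z)=(x\rhd y)\curlyvee z+(x\rhd z)\curlyvee y$.
   Context: $\mathbb{K}$ is a field of characteristic zero and $\mathcal D$ a nonempty set. $\mathbf{T}^{\mathcal D}_{CK}$ is the $\mathbb{K}$-vector space with basis the rooted trees (up to isomorphism) having at least one edge, whose edges are decorated by elements of $\mathcal D$. For such trees $T_1,T_2$ and a vertex $v$ of $T_2$, $T_1\circ_v T_2$ is the tree obtained by identifying the root of $T_1$ with $v$ (root of the result is the root of $T_2$, decorations kept). Let $V^*(T)$ be the set of non-root vertices of $T$ and $R_T$ its root. Define bilinearly $T_1\curlyvee T_2=T_1\circ_{R_{T_2}}T_2$ and $T_1\rhd T_2=\sum_{s\in V^*(T_2)}T_1\circ_s T_2$. -}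

module Defs where

open import Level using (Level; _⊔_; suc)
open import Algebra.Bundles using (CommutativeRing)
open import Data.Nat using (ℕ; zero) renaming (suc to 1+)
open import Data.List using (List; []; _∷_; _++_; map; concatMap)
open import Data.List.Relation.Unary.All using (All)
open import Data.Product using (_×_; _,_; ∃; proj₂)
open import Data.Empty using (⊥)
open import Data.Unit using (⊤)
open import Relation.Nullary using (¬_)
open import Relation.Binary.PropositionalEquality using (_≡_)

record Field (c ℓ : Level) : Set (Level.suc (c ⊔ ℓ)) where
  field
    commutativeRing : CommutativeRing c ℓ
  open CommutativeRing commutativeRing public
  field
    1≉0     : ¬ (1# ≈ 0#)
    inverse : ∀ x → ¬ (x ≈ 0#) → ∃ λ y → (x * y) ≈ 1#

module _ {c ℓ} (K : Field c ℓ) where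
  open Field K

  natToK : ℕ → Carrier
  natToK zero   = 0#
  natToK (1+ n) = 1# + natToK n

  CharacteristicZero : Set ℓ
  CharacteristicZero = ∀ n → ¬ (natToK (1+ n) ≈ 0#)

-- Rooted trees with edges decorated by D.
-- A tree is its root together with the (unordered, see _≅_) list of
-- outgoing edges, each edge carrying a decoration and the subtree below it.

data Tree (D : Set) : Set where
  node : List (D × Tree D) → Tree D

module _ {D : Set} where

  children : Tree D → List (D × Tree D)
  children (node xs) = xs

  HasEdge : Tree D → Set
  HasEdge (node [])      = ⊥
  HasEdge (node (_ ∷ _)) = ⊤

  -- isomorphism of rooted decorated trees (children lists up to
  -- permutation, recursively up to isomorphism)
  data _≅_ : Tree D → Tree D → Set
  data _≋_ : List (D × Tree D) → List (D × Tree D) → Set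

  data _≅_ where
    node≅ : ∀ {xs ys} → xs ≋ ys → node xs ≅ node ys

  data _≋_ where
    []≋  : [] ≋ []
    ∷≋   : ∀ {d e s t xs ys₁ ys₂} → d ≡ e → s ≅ t → xs ≋ (ys₁ ++ ys₂) →
           ((d , s) ∷ xs) ≋ (ys₁ ++ ((e , t) ∷ ys₂))

  -- T₁ ∘_{root} T₂ : the root of T₁ is identified with the root of T₂
  graftRoot : Tree D → Tree D → Tree D
  graftRoot t₁ (node ys) = node (ys ++ children t₁)

  -- For T₂ = node ys: graftAll t T₂ lists T ∘_v T₂ for all vertices v of T₂
  -- (root first); graftBelow t ys lists, for every vertex v strictly below
  -- the root of node ys, the children list of the root of t ∘_v (node ys).
  graftAll   : Tree D → Tree D → List (Tree D)
  graftBelow : Tree D → List (D × Tree D) → List (List (D × Tree D))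

  graftAll t (node ys) = graftRoot t (node ys) ∷ map node (graftBelow t ys)

  graftBelow t [] = []
  graftBelow t ((d , s) ∷ ys) =
    map (λ s' → (d , s') ∷ ys) (graftAll t s)
    ++ map ((d , s) ∷_) (graftBelow t ys)

  graftNonRoot : Tree D → Tree D → List (Tree D)
  graftNonRoot t (node ys) = map node (graftBelow t ys)

-- Free K-module on isomorphism classes of trees, as formal linear
-- combinations modulo the generated congruence.

module Lin {c ℓ} (K : Field c ℓ) (D : Set) where
  open Field K renaming (_+_ to _+K_; _*_ to _*K_; -_ to -K_; _≈_ to _≈K_)

  LinComb : Set c
  LinComb = List (Carrier × Tree D)

  -- x lies in T^D_CK : all its trees have at least one edge
  InTCK : LinComb → Set c
  InTCK = All (λ at → HasEdge (proj₂ at))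

  zeroL : LinComb
  zeroL = []

  _⊕_ : LinComb → LinComb → LinComb
  x ⊕ y = x ++ y

  ⊖_ : LinComb → LinComb
  ⊖ x = map (λ { (a , t) → (-K a , t) }) x

  _⊖_ : LinComb → LinComb → LinComb
  x ⊖ y = x ⊕ (⊖ y)

  infix 4 _≈L_
  data _≈L_ : LinComb → LinComb → Set (c ⊔ ℓ) where
    ≈refl  : ∀ {x} → x ≈L x
    ≈sym   : ∀ {x y} → x ≈L y → y ≈L x
    ≈trans : ∀ {x y z} → x ≈L y → y ≈L z → x ≈L z
    ≈++    : ∀ {x x' y y'} → x ≈L x' → y ≈L y' → (x ++ y) ≈L (x' ++ y')
    ≈swap  : ∀ {x y} → (x ++ y) ≈L (y ++ x)
    ≈tree  : ∀ {a s t} → s ≅ t → ((a , s) ∷ []) ≈L ((a , t) ∷ [])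
    ≈coeff : ∀ {a b t} → a ≈K b → ((a , t) ∷ []) ≈L ((b , t) ∷ [])
    ≈merge : ∀ {a b t} → ((a , t) ∷ (b , t) ∷ []) ≈L ((a +K b , t) ∷ [])
    ≈zero  : ∀ {t} → ((0# , t) ∷ []) ≈L []

  bilin : (Tree D → Tree D → List (Tree D)) → LinComb → LinComb → LinComb
  bilin f x y =
    concatMap (λ { (a , s) →
      concatMap (λ { (b , t) → map (λ u → (a *K b , u)) (f s t) }) y }) x

  _⋎_ : LinComb → LinComb → LinComb
  _⋎_ = bilin (λ s t → graftRoot s t ∷ [])

  _▷_ : LinComb → LinComb → LinComb
  _▷_ = bilin graftNonRoot

  infixl 6 _⊕_ _⊖_
  infixl 7 _⋎_ _▷_

-- Both products are bilinear extensions of operations on trees and both sides of each identity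
-- are additive in every argument, so it suffices to check the identities on single trees.
-- Grafting at the root concatenates lists of children, which gives commutativity and
-- associativity of ⋎ up to reordering children.  In r ▷ (s ▷ t) the tree r is grafted either at
-- a non-root vertex of the grafted copy of s, and these are exactly the terms of (r ▷ s) ▷ t, or
-- at a non-root vertex of t; the associator is therefore the sum of all ways of grafting r and s
-- at non-root vertices of t, which is symmetric in r and s.  Finally, a non-root vertex of y ⋎ z
-- is a non-root vertex of y or of z, which gives the derivation rule.
module Submission where

open import Defs
open import Level using (_⊔_)
open import Relation.Binary.Bundles using (Preorder; Setoid)
import Relation.Binary.Reasoning.Setoid as SetoidReasoning
import Algebra.Solver.CommutativeMonoid as CommutativeMonoidSolver
open import Data.List using (List; []; _∷_; _++_; map; concatMap; [_])
open import Data.List.Properties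
  using (++-assoc; ++-identityʳ; map-++; map-∘; map-id; concatMap-++; concatMap-map; map-concatMap; concatMap-cong; concatMap-pure)
open import Data.List.Membership.Propositional.Properties using (∈-∃++)
open import Data.List.Relation.Unary.Any using (here)
open import Data.List.Relation.Binary.Permutation.Propositional
  using (_↭_; prep; swap; ↭-refl; ↭-sym; ↭-trans; ↭-reflexive; module PermutationReasoning)
open import Data.List.Relation.Binary.Permutation.Propositional.Properties
  using (++-commutativeMonoid; ++⁺; ++⁺ˡ; ++⁺ʳ; map⁺; shift; shifts; ++-comm; ∈-resp-↭; drop-mid; ↭-empty-inv)
open import Data.Product using (_×_; _,_)
open import Relation.Binary.PropositionalEquality
  using (_≡_; refl; sym; trans; cong; cong₂; isEquivalence; module ≡-Reasoning)

module ++-Solver {a} (A : Set a) = CommutativeMonoidSolver (++-commutativeMonoid {A = A})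

module _ {a} {A : Set a} where

  ++-swap-last : (xs ys zs : List A) → (xs ++ ys) ++ zs ↭ (xs ++ zs) ++ ys
  ++-swap-last xs ys zs = begin
    (xs ++ ys) ++ zs  ≡⟨ ++-assoc xs ys zs ⟩
    xs ++ ys ++ zs    ↭⟨ ++⁺ˡ xs (++-comm ys zs) ⟩
    xs ++ zs ++ ys    ≡⟨ sym (++-assoc xs zs ys) ⟩
    (xs ++ zs) ++ ys  ∎
    where open PermutationReasoning

module _ {a b} {A : Set a} {B : Set b} where

  concatMap-singleton : (h : A → B) (xs : List A) → concatMap (λ x → [ h x ]) xs ≡ map h xs
  concatMap-singleton h xs = trans (sym (concatMap-map [_] h xs)) (concatMap-pure (map h xs))

  concatMap-[] : (xs : List A) → concatMap (λ _ → []) xs ≡ [] {A = B}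
  concatMap-[] []       = refl
  concatMap-[] (_ ∷ xs) = concatMap-[] xs

  concatMap⁺ : (f : A → List B) {xs ys : List A} → xs ↭ ys → concatMap f xs ↭ concatMap f ys
  concatMap⁺ f (_↭_.refl)     = ↭-refl
  concatMap⁺ f (prep x p)     = ++⁺ˡ (f x) (concatMap⁺ f p)
  concatMap⁺ f (swap x y p)   = ↭-trans (shifts (f x) (f y)) (++⁺ˡ (f y) (++⁺ˡ (f x) (concatMap⁺ f p)))
  concatMap⁺ f (_↭_.trans p q) = ↭-trans (concatMap⁺ f p) (concatMap⁺ f q)

  concatMap-cong-↭ : {f g : A → List B} (xs : List A) → (∀ x → f x ↭ g x) → concatMap f xs ↭ concatMap g xs
  concatMap-cong-↭ []       f↭g = ↭-refl
  concatMap-cong-↭ (x ∷ xs) f↭g = ++⁺ (f↭g x) (concatMap-cong-↭ xs f↭g)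

  concatMap-++-↭ : (f g : A → List B) (xs : List A) →
    concatMap (λ x → f x ++ g x) xs ↭ concatMap f xs ++ concatMap g xs
  concatMap-++-↭ f g []       = ↭-refl
  concatMap-++-↭ f g (x ∷ xs) = begin
    (f x ++ g x) ++ concatMap (λ x → f x ++ g x) xs   ≡⟨ ++-assoc (f x) (g x) _ ⟩
    f x ++ g x ++ concatMap (λ x → f x ++ g x) xs     ↭⟨ ++⁺ˡ (f x) (++⁺ˡ (g x) (concatMap-++-↭ f g xs)) ⟩
    f x ++ g x ++ concatMap f xs ++ concatMap g xs    ↭⟨ ++⁺ˡ (f x) (shifts (g x) (concatMap f xs)) ⟩
    f x ++ concatMap f xs ++ g x ++ concatMap g xs    ≡⟨ sym (++-assoc (f x) (concatMap f xs) _) ⟩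
    (f x ++ concatMap f xs) ++ g x ++ concatMap g xs  ∎
    where open PermutationReasoning

module _ {a b c} {A : Set a} {B : Set b} {C : Set c} where

  concatMap-map-transpose : (f : A → B → C) (xs : List A) (ys : List B) →
    concatMap (λ x → map (f x) ys) xs ↭ concatMap (λ y → map (λ x → f x y) xs) ys
  concatMap-map-transpose f [] ys = ↭-reflexive (sym (concatMap-[] ys))
  concatMap-map-transpose f (x ∷ xs) ys = begin
    map (f x) ys ++ concatMap (λ x → map (f x) ys) xs
      ↭⟨ ++⁺ˡ (map (f x) ys) (concatMap-map-transpose f xs ys) ⟩
    map (f x) ys ++ concatMap (λ y → map (λ x → f x y) xs) ys
      ≡⟨ cong (_++ _) (sym (concatMap-singleton (f x) ys)) ⟩
    concatMap (λ y → [ f x y ]) ys ++ concatMap (λ y → map (λ x → f x y) xs) ys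
      ↭⟨ ↭-sym (concatMap-++-↭ (λ y → [ f x y ]) (λ y → map (λ x → f x y) xs) ys) ⟩
    concatMap (λ y → map (λ x → f x y) (x ∷ xs)) ys
      ∎
    where open PermutationReasoning

-- Lists that agree up to reordering and replacing elements by R-related ones.  R need not be
-- an equivalence (tree isomorphism _≅_ is not shown to be one), so Permutation.Setoid does not apply.
data PermUpTo {a r} {A : Set a} (R : A → A → Set r) : List A → List A → Set (a ⊔ r) where
  perm : ∀ {xs ys} → xs ↭ ys → PermUpTo R xs ys
  _⟫_  : ∀ {xs ys zs} → PermUpTo R xs ys → PermUpTo R ys zs → PermUpTo R xs zs
  _⧺_  : ∀ {xs xs' ys ys'} → PermUpTo R xs xs' → PermUpTo R ys ys' → PermUpTo R (xs ++ ys) (xs' ++ ys')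
  ⟦_⟧  : ∀ {x y} → R x y → PermUpTo R [ x ] [ y ]

infixr 4 _⟫_
infixr 5 _⧺_

module _ {a r} {A : Set a} {R : A → A → Set r} where

  PermUpTo-refl : ∀ {xs} → PermUpTo R xs xs
  PermUpTo-refl = perm ↭-refl

  PermUpTo-reflexive : ∀ {xs ys} → xs ≡ ys → PermUpTo R xs ys
  PermUpTo-reflexive eq = perm (↭-reflexive eq)

module PermUpTo-Reasoning {a r} {A : Set a} (R : A → A → Set r) where

  private
    preorder : Preorder a a (a ⊔ r)
    preorder = record
      { Carrier    = List A
      ; _≈_        = _≡_
      ; _≲_        = PermUpTo R
      ; isPreorder = record { isEquivalence = isEquivalence ; reflexive = PermUpTo-reflexive ; trans = _⟫_ }
      }

  open import Relation.Binary.Reasoning.Preorder preorder public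

module _ {a b r s} {A : Set a} {B : Set b} {R : A → A → Set r} {S : B → B → Set s} where

  PermUpTo-map : (f : A → B) → (∀ {x y} → R x y → S (f x) (f y)) →
    ∀ {xs ys} → PermUpTo R xs ys → PermUpTo S (map f xs) (map f ys)
  PermUpTo-map f f-resp (perm p)  = perm (map⁺ f p)
  PermUpTo-map f f-resp (p ⟫ q)   = PermUpTo-map f f-resp p ⟫ PermUpTo-map f f-resp q
  PermUpTo-map f f-resp (_⧺_ {xs} {xs'} {ys} {ys'} p q) =
    PermUpTo-reflexive (map-++ f xs ys)
    ⟫ (PermUpTo-map f f-resp p ⧺ PermUpTo-map f f-resp q)
    ⟫ PermUpTo-reflexive (sym (map-++ f xs' ys'))
  PermUpTo-map f f-resp ⟦ r ⟧     = ⟦ f-resp r ⟧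

module _ {D : Set} where

  ≅-refl : (t : Tree D) → t ≅ t
  ≋-refl : (xs : List (D × Tree D)) → xs ≋ xs
  ≅-refl (node xs) = node≅ (≋-refl xs)
  ≋-refl []             = []≋
  ≋-refl ((d , s) ∷ xs) = ∷≋ {ys₁ = []} refl (≅-refl s) (≋-refl xs)

  ↭⇒≋ : (xs : List (D × Tree D)) {ys : List (D × Tree D)} → xs ↭ ys → xs ≋ ys
  ↭⇒≋ [] p rewrite ↭-empty-inv (↭-sym p) = []≋
  ↭⇒≋ ((d , s) ∷ xs) p with ∈-∃++ (∈-resp-↭ p (here refl))
  ... | ys₁ , ys₂ , refl = ∷≋ refl (≅-refl s) (↭⇒≋ xs (drop-mid [] ys₁ p))

  ∷-≋-head : ∀ d ys {t t' : Tree D} → t ≅ t' → ((d , t) ∷ ys) ≋ ((d , t') ∷ ys)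
  ∷-≋-head d ys t≅t' = ∷≋ {ys₁ = []} refl t≅t' (≋-refl ys)

  ∷-≋-tail : ∀ d (t : Tree D) {ys ys'} → ys ≋ ys' → ((d , t) ∷ ys) ≋ ((d , t) ∷ ys')
  ∷-≋-tail d t ys≋ys' = ∷≋ {ys₁ = []} refl (≅-refl t) ys≋ys'

module _ {D : Set} where

  private
    Branch : Set
    Branch = D × Tree D

  graftBelow-++ : (r : Tree D) (xs ys : List Branch) →
    graftBelow r (xs ++ ys) ≡ map (_++ ys) (graftBelow r xs) ++ map (xs ++_) (graftBelow r ys)
  graftBelow-++ r [] ys = sym (map-id (graftBelow r ys))
  graftBelow-++ r ((d , s) ∷ xs) ys = begin
    A' ++ map cons (graftBelow r (xs ++ ys))
      ≡⟨ cong (λ l → A' ++ map cons l) (graftBelow-++ r xs ys) ⟩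
    A' ++ map cons (map (_++ ys) B ++ map (xs ++_) C)
      ≡⟨ cong (A' ++_) (map-++ cons (map (_++ ys) B) _) ⟩
    A' ++ (map cons (map (_++ ys) B) ++ map cons (map (xs ++_) C))
      ≡⟨ sym (++-assoc A' _ _) ⟩
    (A' ++ map cons (map (_++ ys) B)) ++ map cons (map (xs ++_) C)
      ≡⟨ cong₂ _++_ (cong₂ _++_ (map-∘ A) (trans (sym (map-∘ B)) (map-∘ B))) (sym (map-∘ C)) ⟩
    (map (_++ ys) (map (λ s' → (d , s') ∷ xs) A) ++ map (_++ ys) (map cons B)) ++ map (((d , s) ∷ xs) ++_) C
      ≡⟨ cong (_++ map (((d , s) ∷ xs) ++_) C) (sym (map-++ (_++ ys) (map (λ s' → (d , s') ∷ xs) A) _)) ⟩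
    map (_++ ys) (map (λ s' → (d , s') ∷ xs) A ++ map cons B) ++ map (((d , s) ∷ xs) ++_) C
      ∎
    where
    open ≡-Reasoning
    A : List (Tree D)
    A = graftAll r s
    B : List (List Branch)
    B = graftBelow r xs
    C : List (List Branch)
    C = graftBelow r ys
    cons : List Branch → List Branch
    cons = (d , s) ∷_
    A' : List (List Branch)
    A' = map (λ s' → (d , s') ∷ xs ++ ys) A

  nestedAll : Tree D → Tree D → Tree D → List (Tree D)
  nestedAll r s t = concatMap (graftAll r) (graftAll s t)

  nestedBelow : Tree D → Tree D → List Branch → List (List Branch)
  nestedBelow r s ys = concatMap (graftBelow r) (graftBelow s ys)

  composedAll : Tree D → Tree D → Tree D → List (Tree D)
  composedAll r s t = concatMap (λ u → graftAll (node u) t) (graftBelow r (children s))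

  composedBelow : Tree D → Tree D → List Branch → List (List Branch)
  composedBelow r s ys = concatMap (λ u → graftBelow (node u) ys) (graftBelow r (children s))

  -- h grafted into the first branch (d , t), k into the remaining branches ys
  headTail : Tree D → Tree D → D → Tree D → List Branch → List (List Branch)
  headTail h k d t ys = concatMap (λ t' → map ((d , t') ∷_) (graftBelow k ys)) (graftAll h t)

  tailHead : Tree D → Tree D → D → Tree D → List Branch → List (List Branch)
  tailHead k h d t ys = concatMap (λ u → map (λ t' → (d , t') ∷ u) (graftAll h t)) (graftBelow k ys)

  -- pairAll r s t: r and s grafted at two, not necessarily distinct, vertices of t
  pairAll   : Tree D → Tree D → Tree D → List (Tree D)
  pairBelow : Tree D → Tree D → List Branch → List (List Branch)
  pairAll r s (node ys) = node ((ys ++ children s) ++ children r)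
    ∷ (map (λ u → node (u ++ children s)) (graftBelow r ys)
       ++ (map (λ u → node (u ++ children r)) (graftBelow s ys) ++ map node (pairBelow r s ys)))
  pairBelow r s [] = []
  pairBelow r s ((d , t) ∷ ys) = map (λ t' → (d , t') ∷ ys) (pairAll r s t)
    ++ (headTail s r d t ys ++ (tailHead s r d t ys ++ map ((d , t) ∷_) (pairBelow r s ys)))

  headTail-↭-tailHead : ∀ h k d t ys → headTail h k d t ys ↭ tailHead k h d t ys
  headTail-↭-tailHead h k d t ys = concatMap-map-transpose (λ t' u → (d , t') ∷ u) (graftAll h t) (graftBelow k ys)

  pairAll-comm   : ∀ r s t → PermUpTo _≅_ (pairAll r s t) (pairAll s r t)
  pairBelow-comm : ∀ r s ys → PermUpTo _≋_ (pairBelow r s ys) (pairBelow s r ys)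
  pairAll-comm r s (node ys) =
    ⟦ node≅ (↭⇒≋ _ (++-swap-last ys (children s) (children r))) ⟧
    ⧺ (PermUpTo-refl {xs = r-below} ⧺ PermUpTo-refl {xs = s-below} ⧺ PermUpTo-map node node≅ (pairBelow-comm r s ys)
       ⟫ perm (shifts r-below s-below))
    where
    r-below : List (Tree D)
    r-below = map (λ u → node (u ++ children s)) (graftBelow r ys)
    s-below : List (Tree D)
    s-below = map (λ u → node (u ++ children r)) (graftBelow s ys)
  pairBelow-comm r s [] = PermUpTo-refl
  pairBelow-comm r s ((d , t) ∷ ys) =
    PermUpTo-map (λ t' → (d , t') ∷ ys) (∷-≋-head d ys) (pairAll-comm r s t)
    ⧺ (perm (headTail-↭-tailHead s r d t ys)
       ⧺ perm (↭-sym (headTail-↭-tailHead r s d t ys))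
       ⧺ PermUpTo-map ((d , t) ∷_) (∷-≋-tail d t) (pairBelow-comm r s ys)
       ⟫ perm (shifts (tailHead r s d t ys) (headTail r s d t ys)))

  composedAll-node : ∀ r s ys →
    composedAll r s (node ys) ↭ map (λ u → node (ys ++ u)) (graftBelow r (children s)) ++ map node (composedBelow r s ys)
  composedAll-node r s ys = begin
    concatMap (λ u → [ node (ys ++ u) ] ++ map node (graftBelow (node u) ys)) r∘s
      ↭⟨ concatMap-++-↭ _ _ r∘s ⟩
    concatMap (λ u → [ node (ys ++ u) ]) r∘s ++ concatMap (λ u → map node (graftBelow (node u) ys)) r∘s
      ≡⟨ cong₂ _++_ (concatMap-singleton _ r∘s) (sym (map-concatMap node (λ u → graftBelow (node u) ys) r∘s)) ⟩
    map (λ u → node (ys ++ u)) r∘s ++ map node (composedBelow r s ys)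
      ∎
    where
    open PermutationReasoning
    r∘s : List (List Branch)
    r∘s = graftBelow r (children s)

  composedBelow-∷ : ∀ r s d t ys →
    composedBelow r s ((d , t) ∷ ys) ↭
      map (λ t' → (d , t') ∷ ys) (composedAll r s t) ++ map ((d , t) ∷_) (composedBelow r s ys)
  composedBelow-∷ r s d t ys = begin
    concatMap (λ u → map at-head (graftAll (node u) t) ++ map at-tail (graftBelow (node u) ys)) r∘s
      ↭⟨ concatMap-++-↭ _ _ r∘s ⟩
    concatMap (λ u → map at-head (graftAll (node u) t)) r∘s ++ concatMap (λ u → map at-tail (graftBelow (node u) ys)) r∘s
      ≡⟨ sym (cong₂ _++_ (map-concatMap at-head (λ u → graftAll (node u) t) r∘s)
                         (map-concatMap at-tail (λ u → graftBelow (node u) ys) r∘s)) ⟩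
    map at-head (composedAll r s t) ++ map at-tail (composedBelow r s ys)
      ∎
    where
    open PermutationReasoning
    r∘s : List (List Branch)
    r∘s = graftBelow r (children s)
    at-head : Tree D → List Branch
    at-head t' = (d , t') ∷ ys
    at-tail : List Branch → List Branch
    at-tail = (d , t) ∷_

  nestedAll-node : ∀ r s ys →
    nestedAll r s (node ys) ↭
      (node ((ys ++ children s) ++ children r) ∷ map (λ u → node (u ++ children s)) (graftBelow r ys)
                                              ++ map (λ u → node (ys ++ u)) (graftBelow r (children s)))
      ++ map (λ u → node (u ++ children r)) (graftBelow s ys) ++ map node (nestedBelow r s ys)
  nestedAll-node r s ys = begin
    (root ∷ map node (graftBelow r (ys ++ children s))) ++ concatMap (graftAll r) (map node (graftBelow s ys))
      ≡⟨ cong₂ (λ l l' → (root ∷ l) ++ l') graftBelow-ys++s (concatMap-map (graftAll r) node (graftBelow s ys)) ⟩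
    (root ∷ r-below ++ r-in-s) ++ concatMap (λ u → [ node (u ++ children r) ] ++ map node (graftBelow r u)) (graftBelow s ys)
      ↭⟨ ++⁺ˡ (root ∷ r-below ++ r-in-s) (concatMap-++-↭ _ _ (graftBelow s ys)) ⟩
    (root ∷ r-below ++ r-in-s) ++ concatMap (λ u → [ node (u ++ children r) ]) (graftBelow s ys)
                               ++ concatMap (λ u → map node (graftBelow r u)) (graftBelow s ys)
      ≡⟨ cong (λ l → (root ∷ r-below ++ r-in-s) ++ l)
              (cong₂ _++_ (concatMap-singleton _ (graftBelow s ys)) (sym (map-concatMap node (graftBelow r) (graftBelow s ys)))) ⟩
    (root ∷ r-below ++ r-in-s) ++ map (λ u → node (u ++ children r)) (graftBelow s ys) ++ map node (nestedBelow r s ys)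
      ∎
    where
    open PermutationReasoning
    root : Tree D
    root    = node ((ys ++ children s) ++ children r)
    r-below : List (Tree D)
    r-below = map (λ u → node (u ++ children s)) (graftBelow r ys)
    r-in-s : List (Tree D)
    r-in-s  = map (λ u → node (ys ++ u)) (graftBelow r (children s))
    graftBelow-ys++s : map node (graftBelow r (ys ++ children s)) ≡ r-below ++ r-in-s
    graftBelow-ys++s = trans (cong (map node) (graftBelow-++ r ys (children s)))
      (trans (map-++ node (map (_++ children s) (graftBelow r ys)) _)
             (sym (cong₂ _++_ (map-∘ (graftBelow r ys)) (map-∘ (graftBelow r (children s))))))

  nestedBelow-∷ : ∀ r s d t ys →
    nestedBelow r s ((d , t) ∷ ys) ↭
      (map (λ t' → (d , t') ∷ ys) (nestedAll r s t) ++ headTail s r d t ys)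
      ++ tailHead s r d t ys ++ map ((d , t) ∷_) (nestedBelow r s ys)
  nestedBelow-∷ r s d t ys = begin
    concatMap (graftBelow r) (map at-head (graftAll s t) ++ map at-tail (graftBelow s ys))
      ≡⟨ trans (concatMap-++ (graftBelow r) (map at-head (graftAll s t)) _)
               (cong₂ _++_ (concatMap-map _ _ (graftAll s t)) (concatMap-map _ _ (graftBelow s ys))) ⟩
    concatMap (λ t' → map at-head (graftAll r t') ++ map ((d , t') ∷_) (graftBelow r ys)) (graftAll s t)
      ++ concatMap (λ u → map (λ t' → (d , t') ∷ u) (graftAll r t) ++ map at-tail (graftBelow r u)) (graftBelow s ys)
      ↭⟨ ++⁺ (concatMap-++-↭ _ _ (graftAll s t)) (concatMap-++-↭ _ _ (graftBelow s ys)) ⟩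
    (concatMap (λ t' → map at-head (graftAll r t')) (graftAll s t) ++ headTail s r d t ys)
      ++ tailHead s r d t ys ++ concatMap (λ u → map at-tail (graftBelow r u)) (graftBelow s ys)
      ≡⟨ sym (cong₂ (λ l l' → (l ++ headTail s r d t ys) ++ tailHead s r d t ys ++ l')
                    (map-concatMap at-head (graftAll r) (graftAll s t))
                    (map-concatMap at-tail (graftBelow r) (graftBelow s ys))) ⟩
    (map at-head (nestedAll r s t) ++ headTail s r d t ys) ++ tailHead s r d t ys ++ map at-tail (nestedBelow r s ys)
      ∎
    where
    open PermutationReasoning
    at-head : Tree D → List Branch
    at-head t' = (d , t') ∷ ys
    at-tail : List Branch → List Branch
    at-tail = (d , t) ∷_

  -- Grafting s at a vertex v of t and then r at a vertex w of the result either puts w inside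
  -- the copy of s (the composed terms) or not (the pair terms).
  nestedAll-split   : ∀ r s t → PermUpTo _≅_ (nestedAll r s t) (composedAll r s t ++ pairAll r s t)
  nestedBelow-split : ∀ r s ys → PermUpTo _≋_ (nestedBelow r s ys) (composedBelow r s ys ++ pairBelow r s ys)
  nestedAll-split r s (node ys) = begin
    nestedAll r s (node ys)
      ≲⟨ perm (nestedAll-node r s ys) ⟩
    (root ∷ r-below ++ r-in-s) ++ s-below ++ map node (nestedBelow r s ys)
      ≲⟨ PermUpTo-refl {xs = root ∷ r-below ++ r-in-s} ⧺ PermUpTo-refl {xs = s-below}
         ⧺ PermUpTo-map node node≅ (nestedBelow-split r s ys) ⟩
    (root ∷ r-below ++ r-in-s) ++ s-below ++ map node (composedBelow r s ys ++ pairBelow r s ys)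
      ≡⟨ cong (λ l → (root ∷ r-below ++ r-in-s) ++ s-below ++ l) (map-++ node (composedBelow r s ys) _) ⟩
    (root ∷ r-below ++ r-in-s) ++ s-below ++ map node (composedBelow r s ys) ++ map node (pairBelow r s ys)
      ≲⟨ perm (regroup [ root ] r-below r-in-s s-below _ _) ⟩
    (r-in-s ++ map node (composedBelow r s ys)) ++ pairAll r s (node ys)
      ≲⟨ perm (↭-sym (++⁺ʳ _ (composedAll-node r s ys))) ⟩
    composedAll r s (node ys) ++ pairAll r s (node ys)
      ∎
    where
    open PermUpTo-Reasoning _≅_
    open ++-Solver (Tree D) using (solve; _⊕_; _⊜_)
    root : Tree D
    root    = node ((ys ++ children s) ++ children r)
    r-below : List (Tree D)
    r-below = map (λ u → node (u ++ children s)) (graftBelow r ys)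
    r-in-s : List (Tree D)
    r-in-s  = map (λ u → node (ys ++ u)) (graftBelow r (children s))
    s-below : List (Tree D)
    s-below = map (λ u → node (u ++ children r)) (graftBelow s ys)
    regroup : (a b c d e f : List (Tree D)) → (a ++ b ++ c) ++ d ++ e ++ f ↭ (c ++ e) ++ a ++ b ++ d ++ f
    regroup = solve 6 (λ a b c d e f → (a ⊕ (b ⊕ c)) ⊕ (d ⊕ (e ⊕ f)) ⊜ (c ⊕ e) ⊕ (a ⊕ (b ⊕ (d ⊕ f)))) ↭-refl
  nestedBelow-split r s [] =
    PermUpTo-reflexive (sym (trans (++-identityʳ _) (concatMap-[] (graftBelow r (children s)))))
  nestedBelow-split r s ((d , t) ∷ ys) = begin
    nestedBelow r s ((d , t) ∷ ys)
      ≲⟨ perm (nestedBelow-∷ r s d t ys) ⟩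
    (map at-head (nestedAll r s t) ++ headTail s r d t ys) ++ tailHead s r d t ys ++ map at-tail (nestedBelow r s ys)
      ≲⟨ (PermUpTo-map at-head (∷-≋-head d ys) (nestedAll-split r s t) ⧺ PermUpTo-refl {xs = headTail s r d t ys})
         ⧺ PermUpTo-refl {xs = tailHead s r d t ys} ⧺ PermUpTo-map at-tail (∷-≋-tail d t) (nestedBelow-split r s ys) ⟩
    (map at-head (composedAll r s t ++ pairAll r s t) ++ headTail s r d t ys)
      ++ tailHead s r d t ys ++ map at-tail (composedBelow r s ys ++ pairBelow r s ys)
      ≡⟨ cong₂ (λ l l' → (l ++ headTail s r d t ys) ++ tailHead s r d t ys ++ l')
               (map-++ at-head (composedAll r s t) _) (map-++ at-tail (composedBelow r s ys) _) ⟩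
    ((map at-head (composedAll r s t) ++ map at-head (pairAll r s t)) ++ headTail s r d t ys)
      ++ tailHead s r d t ys ++ map at-tail (composedBelow r s ys) ++ map at-tail (pairBelow r s ys)
      ≲⟨ perm (regroup (map at-head (composedAll r s t)) (map at-head (pairAll r s t)) (headTail s r d t ys)
                      (tailHead s r d t ys) (map at-tail (composedBelow r s ys)) (map at-tail (pairBelow r s ys))) ⟩
    (map at-head (composedAll r s t) ++ map at-tail (composedBelow r s ys)) ++ pairBelow r s ((d , t) ∷ ys)
      ≲⟨ perm (↭-sym (++⁺ʳ _ (composedBelow-∷ r s d t ys))) ⟩
    composedBelow r s ((d , t) ∷ ys) ++ pairBelow r s ((d , t) ∷ ys)
      ∎
    where
    open PermUpTo-Reasoning _≋_
    open ++-Solver (List Branch) using (solve; _⊕_; _⊜_)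
    at-head : Tree D → List Branch
    at-head t' = (d , t') ∷ ys
    at-tail : List Branch → List Branch
    at-tail = (d , t) ∷_
    regroup : (a b c d e f : List (List Branch)) → ((a ++ b) ++ c) ++ d ++ e ++ f ↭ (a ++ e) ++ b ++ c ++ d ++ f
    regroup = solve 6 (λ a b c d e f → ((a ⊕ b) ⊕ c) ⊕ (d ⊕ (e ⊕ f)) ⊜ (a ⊕ e) ⊕ (b ⊕ (c ⊕ (d ⊕ f)))) ↭-refl

module _ {c ℓ} (K : Field c ℓ) (D : Set) where

  open Lin K D
  open Field K
    using (Carrier; *-comm; *-assoc; -‿inverseʳ; -‿cong; *-commutativeSemigroup)
    renaming (_*_ to _*K_; -_ to -K_; _≈_ to _≈K_; sym to ≈K-sym)
  open import Algebra.Properties.CommutativeSemigroup *-commutativeSemigroup using (x∙yz≈y∙xz; x∙yz≈xz∙y)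

  private
    Term : Set c
    Term = Carrier × Tree D

  ≈L-setoid : Setoid c (c ⊔ ℓ)
  ≈L-setoid = record
    { Carrier       = LinComb
    ; _≈_           = _≈L_
    ; isEquivalence = record { refl = ≈refl ; sym = ≈sym ; trans = ≈trans }
    }

  module ≈L-Reasoning = SetoidReasoning ≈L-setoid

  ≡⇒≈L : ∀ {x y} → x ≡ y → x ≈L y
  ≡⇒≈L refl = ≈refl

  ↭⇒≈L : ∀ {x y} → x ↭ y → x ≈L y
  ↭⇒≈L (_↭_.refl)      = ≈refl
  ↭⇒≈L (prep p x↭y)    = ≈++ {x = [ p ]} ≈refl (↭⇒≈L x↭y)
  ↭⇒≈L (swap p q x↭y)  = ≈++ {x = p ∷ q ∷ []} (≈swap {x = [ p ]} {y = [ q ]}) (↭⇒≈L x↭y)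
  ↭⇒≈L (_↭_.trans p q) = ≈trans (↭⇒≈L p) (↭⇒≈L q)

  ≈L-term : ∀ {a b s t} → a ≈K b → s ≅ t → [ (a , s) ] ≈L [ (b , t) ]
  ≈L-term a≈b s≅t = ≈trans (≈coeff a≈b) (≈tree s≅t)

  module _ {A : Set} where

    map-≈L : (f g : A → Term) → (∀ w → [ f w ] ≈L [ g w ]) → ∀ ws → map f ws ≈L map g ws
    map-≈L f g f≈g []       = ≈refl
    map-≈L f g f≈g (w ∷ ws) = ≈++ {x = [ f w ]} (f≈g w) (map-≈L f g f≈g ws)

    PermUpTo⇒≈L : ∀ {R : A → A → Set} (h : A → Term) → (∀ {u v} → R u v → [ h u ] ≈L [ h v ]) →
      ∀ {ws ws'} → PermUpTo R ws ws' → map h ws ≈L map h ws'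
    PermUpTo⇒≈L h h-resp (perm p)  = ↭⇒≈L (map⁺ h p)
    PermUpTo⇒≈L h h-resp (p ⟫ q)   = ≈trans (PermUpTo⇒≈L h h-resp p) (PermUpTo⇒≈L h h-resp q)
    PermUpTo⇒≈L h h-resp (_⧺_ {xs} {xs'} {ys} {ys'} p q) =
      ≈trans (≡⇒≈L (map-++ h xs ys))
        (≈trans (≈++ (PermUpTo⇒≈L h h-resp p) (PermUpTo⇒≈L h h-resp q)) (≡⇒≈L (sym (map-++ h xs' ys'))))
    PermUpTo⇒≈L h h-resp ⟦ r ⟧     = h-resp r

  ⊖-inverseʳ : ∀ x → x ⊖ x ≈L []
  ⊖-inverseʳ []            = ≈refl
  ⊖-inverseʳ ((a , t) ∷ x) = begin
    (a , t) ∷ x ++ (-K a , t) ∷ ⊖ x     ≈⟨ ↭⇒≈L (prep (a , t) (shift (-K a , t) x (⊖ x))) ⟩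
    (a , t) ∷ (-K a , t) ∷ x ++ ⊖ x     ≈⟨ ≈++ (≈trans ≈merge (≈trans (≈coeff (-‿inverseʳ a)) ≈zero)) (⊖-inverseʳ x) ⟩
    []                                  ∎
    where open ≈L-Reasoning

  ⊕-⊖-cancelˡ : ∀ x y → (x ⊕ y) ⊖ x ≈L y
  ⊕-⊖-cancelˡ x y = begin
    (x ++ y) ++ ⊖ x   ≈⟨ ↭⇒≈L (++-swap-last x y (⊖ x)) ⟩
    (x ++ ⊖ x) ++ y   ≈⟨ ≈++ (⊖-inverseʳ x) ≈refl ⟩
    y                 ∎
    where open ≈L-Reasoning

  scaledSum : Carrier → List (List (D × Tree D)) → LinComb
  scaledSum k ws = map (λ w → (k , node w)) ws

  scaledSum-cong : ∀ {k k'} ws → k ≈K k' → scaledSum k ws ≈L scaledSum k' ws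
  scaledSum-cong ws k≈k' = map-≈L _ _ (λ _ → ≈coeff k≈k') ws

  ⊖-scaledSum : ∀ k ws → ⊖ scaledSum k ws ≡ scaledSum (-K k) ws
  ⊖-scaledSum k ws = sym (map-∘ ws)

  record Additive (F : LinComb → LinComb) : Set c where
    field
      ↭-cong : ∀ {x y} → x ↭ y → F x ↭ F y
      []-hom : F [] ↭ []
      ⊕-hom  : ∀ x y → F (x ⊕ y) ↭ F x ⊕ F y

  open Additive

  ∘-additive : ∀ {F G} → Additive F → Additive G → Additive (λ x → G (F x))
  ∘-additive {F} {G} F-add G-add = record
    { ↭-cong = λ x↭y → ↭-cong G-add (↭-cong F-add x↭y)
    ; []-hom = ↭-trans (↭-cong G-add ([]-hom F-add)) ([]-hom G-add)
    ; ⊕-hom  = λ x y → ↭-trans (↭-cong G-add (⊕-hom F-add x y)) (⊕-hom G-add (F x) (F y))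
    }

  ⊕-additive : ∀ {F G} → Additive F → Additive G → Additive (λ x → F x ⊕ G x)
  ⊕-additive {F} {G} F-add G-add = record
    { ↭-cong = λ x↭y → ++⁺ (↭-cong F-add x↭y) (↭-cong G-add x↭y)
    ; []-hom = ++⁺ ([]-hom F-add) ([]-hom G-add)
    ; ⊕-hom  = λ x y → ↭-trans (++⁺ (⊕-hom F-add x y) (⊕-hom G-add x y)) (interchange (F x) (F y) (G x) (G y))
    }
    where
    open ++-Solver Term using (solve; _⊜_) renaming (_⊕_ to _⊞_)
    interchange : (a b c d : LinComb) → (a ++ b) ++ (c ++ d) ↭ (a ++ c) ++ (b ++ d)
    interchange = solve 4 (λ a b c d → (a ⊞ b) ⊞ (c ⊞ d) ⊜ (a ⊞ c) ⊞ (b ⊞ d)) ↭-refl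

  ⊖-additive : ∀ {F G} → Additive F → Additive G → Additive (λ x → F x ⊖ G x)
  ⊖-additive {G = G} F-add G-add = ⊕-additive F-add (record
    { ↭-cong = λ x↭y → map⁺ _ (↭-cong G-add x↭y)
    ; []-hom = map⁺ _ ([]-hom G-add)
    ; ⊕-hom  = λ x y → ↭-trans (map⁺ _ (⊕-hom G-add x y)) (↭-reflexive (map-++ _ (G x) (G y)))
    })

  record Additive₂ (F : LinComb → LinComb → LinComb) : Set c where
    field
      additive₁ : ∀ y → Additive (λ x → F x y)
      additive₂ : ∀ x → Additive (λ y → F x y)

  record Additive₃ (F : LinComb → LinComb → LinComb → LinComb) : Set c where
    field
      additive₁ : ∀ y z → Additive (λ x → F x y z)
      additive₂ : ∀ x z → Additive (λ y → F x y z)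
      additive₃ : ∀ x y → Additive (λ z → F x y z)

  Additive₂-flip : ∀ {F} → Additive₂ F → Additive₂ (λ x y → F y x)
  Additive₂-flip F-add = record { additive₁ = additive₂ ; additive₂ = additive₁ }
    where open Additive₂ F-add

  Additive₃-swap : ∀ {F} → Additive₃ F → Additive₃ (λ x y z → F y x z)
  Additive₃-swap F-add = record
    { additive₁ = additive₂ ; additive₂ = additive₁ ; additive₃ = λ x y → additive₃ y x }
    where open Additive₃ F-add

  bilin-additive₂ : ∀ f → Additive₂ (bilin f)
  bilin-additive₂ f = record
    { additive₁ = λ y → record
      { ↭-cong = concatMap⁺ _
      ; []-hom = ↭-refl
      ; ⊕-hom  = λ x x' → ↭-reflexive (concatMap-++ _ x x')
      }
    ; additive₂ = λ x → record
      { ↭-cong = λ y↭y' → concatMap-cong-↭ x (λ _ → concatMap⁺ _ y↭y')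
      ; []-hom = ↭-reflexive (concatMap-[] x)
      ; ⊕-hom  = λ y y' → ↭-trans (concatMap-cong-↭ x (λ _ → ↭-reflexive (concatMap-++ _ y y'))) (concatMap-++-↭ _ _ x)
      }
    }

  ≈L-by-singletons : ∀ {F G} → Additive F → Additive G → (∀ p → F [ p ] ≈L G [ p ]) → ∀ x → F x ≈L G x
  ≈L-by-singletons F-add G-add F≈G [] = ≈trans (↭⇒≈L ([]-hom F-add)) (≈sym (↭⇒≈L ([]-hom G-add)))
  ≈L-by-singletons {F} {G} F-add G-add F≈G (p ∷ x) = begin
    F ([ p ] ⊕ x)     ≈⟨ ↭⇒≈L (⊕-hom F-add [ p ] x) ⟩
    F [ p ] ⊕ F x     ≈⟨ ≈++ (F≈G p) (≈L-by-singletons F-add G-add F≈G x) ⟩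
    G [ p ] ⊕ G x     ≈⟨ ≈sym (↭⇒≈L (⊕-hom G-add [ p ] x)) ⟩
    G ([ p ] ⊕ x)     ∎
    where open ≈L-Reasoning

  ≈L-by-singletons₂ : ∀ {F G} → Additive₂ F → Additive₂ G →
    (∀ p q → F [ p ] [ q ] ≈L G [ p ] [ q ]) → ∀ x y → F x y ≈L G x y
  ≈L-by-singletons₂ F-add G-add F≈G x y =
    ≈L-by-singletons (F.additive₁ y) (G.additive₁ y)
      (λ p → ≈L-by-singletons (F.additive₂ [ p ]) (G.additive₂ [ p ]) (F≈G p) y) x
    where
    module F = Additive₂ F-add
    module G = Additive₂ G-add

  ≈L-by-singletons₃ : ∀ {F G} → Additive₃ F → Additive₃ G →
    (∀ p q w → F [ p ] [ q ] [ w ] ≈L G [ p ] [ q ] [ w ]) → ∀ x y z → F x y z ≈L G x y z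
  ≈L-by-singletons₃ F-add G-add F≈G x y z =
    ≈L-by-singletons (F.additive₁ y z) (G.additive₁ y z)
      (λ p → ≈L-by-singletons₂ (fix F-add p) (fix G-add p) (F≈G p) y z) x
    where
    module F = Additive₃ F-add
    module G = Additive₃ G-add
    fix : ∀ {H} → Additive₃ H → ∀ p → Additive₂ (H [ p ])
    fix H-add p = record { additive₁ = λ z → additive₂ [ p ] z ; additive₂ = additive₃ [ p ] }
      where open Additive₃ H-add

  ⋎-additive₂ : Additive₂ _⋎_
  ⋎-additive₂ = bilin-additive₂ (λ s t → [ graftRoot s t ])

  ▷-additive₂ : Additive₂ _▷_
  ▷-additive₂ = bilin-additive₂ graftNonRoot

  open Additive₂ ⋎-additive₂ renaming (additive₁ to ⋎-additiveˡ; additive₂ to ⋎-additiveʳ)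
  open Additive₂ ▷-additive₂ renaming (additive₁ to ▷-additiveˡ; additive₂ to ▷-additiveʳ)

  ▷-trees : ∀ a r b ys → [ (a , r) ] ▷ [ (b , node ys) ] ≡ scaledSum (a *K b) (graftBelow r ys)
  ▷-trees a r b ys = trans (++-identityʳ _) (trans (++-identityʳ _) (sym (map-∘ (graftBelow r ys))))

  ▷-scaledSumʳ : ∀ a r k ws → [ (a , r) ] ▷ scaledSum k ws ≡ scaledSum (a *K k) (concatMap (graftBelow r) ws)
  ▷-scaledSumʳ a r k ws = begin
    [ (a , r) ] ▷ scaledSum k ws
      ≡⟨ trans (++-identityʳ _) (concatMap-map _ _ ws) ⟩
    concatMap (λ w → map (a *K k ,_) (map node (graftBelow r w))) ws
      ≡⟨ concatMap-cong (λ w → sym (map-∘ (graftBelow r w))) ws ⟩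
    concatMap (λ w → scaledSum (a *K k) (graftBelow r w)) ws
      ≡⟨ sym (map-concatMap _ (graftBelow r) ws) ⟩
    scaledSum (a *K k) (concatMap (graftBelow r) ws)
      ∎
    where open ≡-Reasoning

  ▷-scaledSumˡ : ∀ k ws c ys →
    scaledSum k ws ▷ [ (c , node ys) ] ≡ scaledSum (k *K c) (concatMap (λ w → graftBelow (node w) ys) ws)
  ▷-scaledSumˡ k []       c ys = refl
  ▷-scaledSumˡ k (w ∷ ws) c ys = trans
    (cong₂ _++_ (trans (++-identityʳ _) (sym (map-∘ (graftBelow (node w) ys)))) (▷-scaledSumˡ k ws c ys))
    (sym (map-++ _ (graftBelow (node w) ys) _))

  ⋎-scaledSumˡ : ∀ k ws c ts → scaledSum k ws ⋎ [ (c , node ts) ] ≡ map (λ w → (k *K c , node (ts ++ w))) ws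
  ⋎-scaledSumˡ k []       c ts = refl
  ⋎-scaledSumˡ k (w ∷ ws) c ts = cong (_ ∷_) (⋎-scaledSumˡ k ws c ts)

  -- Root grafting of two single trees computes to a single term, so only its coefficient and
  -- the order of the root's children need adjusting.
  ⋎-comm-trees : ∀ p q → [ p ] ⋎ [ q ] ≈L [ q ] ⋎ [ p ]
  ⋎-comm-trees (a , node ss) (b , node ts) = ≈L-term (*-comm a b) (node≅ (↭⇒≋ (ts ++ ss) (++-comm ts ss)))

  ⋎-assoc-trees : ∀ p q w → ([ p ] ⋎ [ q ]) ⋎ [ w ] ≈L [ p ] ⋎ ([ q ] ⋎ [ w ])
  ⋎-assoc-trees (a , node rs) (b , node ss) (c , node ts) =
    ≈L-term (*-assoc a b c) (node≅ (↭⇒≋ (ts ++ ss ++ rs) (↭-reflexive (sym (++-assoc ts ss rs)))))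

  ⋎-comm : ∀ x y → x ⋎ y ≈L y ⋎ x
  ⋎-comm = ≈L-by-singletons₂ ⋎-additive₂ (Additive₂-flip ⋎-additive₂) ⋎-comm-trees

  ⋎-assoc : ∀ x y z → (x ⋎ y) ⋎ z ≈L x ⋎ (y ⋎ z)
  ⋎-assoc = ≈L-by-singletons₃
    (record { additive₁ = λ y z → ∘-additive (⋎-additiveˡ y) (⋎-additiveˡ z)
            ; additive₂ = λ x z → ∘-additive (⋎-additiveʳ x) (⋎-additiveˡ z)
            ; additive₃ = λ x y → ⋎-additiveʳ (x ⋎ y) })
    (record { additive₁ = λ y z → ⋎-additiveˡ (y ⋎ z)
            ; additive₂ = λ x z → ∘-additive (⋎-additiveˡ z) (⋎-additiveʳ x)
            ; additive₃ = λ x y → ∘-additive (⋎-additiveʳ y) (⋎-additiveʳ x) })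
    ⋎-assoc-trees

  associator : LinComb → LinComb → LinComb → LinComb
  associator x y z = (x ▷ (y ▷ z)) ⊖ ((x ▷ y) ▷ z)

  associator-trees : ∀ a r b s c ys →
    associator [ (a , r) ] [ (b , s) ] [ (c , node ys) ] ≈L scaledSum (a *K (b *K c)) (pairBelow r s ys)
  associator-trees a r b (node ss) c ys = begin
    associator [ (a , r) ] [ (b , node ss) ] [ (c , node ys) ]
      ≡⟨ cong₂ _⊖_ nested composed ⟩
    scaledSum k (nestedBelow r (node ss) ys) ⊖ scaledSum k' (composedBelow r (node ss) ys)
      ≈⟨ ≈++ (PermUpTo⇒≈L (λ w → (k , node w)) (λ ws≋ws' → ≈tree (node≅ ws≋ws')) (nestedBelow-split r (node ss) ys))
             (≈sym negated-composed) ⟩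
    scaledSum k (composedBelow r (node ss) ys ++ pairBelow r (node ss) ys) ⊖ scaledSum k (composedBelow r (node ss) ys)
      ≡⟨ cong (_⊖ scaledSum k (composedBelow r (node ss) ys)) (map-++ _ (composedBelow r (node ss) ys) _) ⟩
    (scaledSum k (composedBelow r (node ss) ys) ⊕ scaledSum k (pairBelow r (node ss) ys)) ⊖ scaledSum k (composedBelow r (node ss) ys)
      ≈⟨ ⊕-⊖-cancelˡ (scaledSum k (composedBelow r (node ss) ys)) _ ⟩
    scaledSum k (pairBelow r (node ss) ys)
      ∎
    where
    open ≈L-Reasoning
    k : Carrier
    k = a *K (b *K c)
    k' : Carrier
    k' = (a *K b) *K c
    nested : [ (a , r) ] ▷ ([ (b , node ss) ] ▷ [ (c , node ys) ]) ≡ scaledSum k (nestedBelow r (node ss) ys)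
    nested = trans (cong ([ (a , r) ] ▷_) (▷-trees b (node ss) c ys)) (▷-scaledSumʳ a r (b *K c) (graftBelow (node ss) ys))
    composed : ([ (a , r) ] ▷ [ (b , node ss) ]) ▷ [ (c , node ys) ] ≡ scaledSum k' (composedBelow r (node ss) ys)
    composed = trans (cong (_▷ [ (c , node ys) ]) (▷-trees a r b ss)) (▷-scaledSumˡ (a *K b) (graftBelow r ss) c ys)
    negated-composed : ⊖ scaledSum k (composedBelow r (node ss) ys) ≈L ⊖ scaledSum k' (composedBelow r (node ss) ys)
    negated-composed = begin
      ⊖ scaledSum k (composedBelow r (node ss) ys)       ≡⟨ ⊖-scaledSum k _ ⟩
      scaledSum (-K k) (composedBelow r (node ss) ys)     ≈⟨ scaledSum-cong _ (-‿cong (≈K-sym (*-assoc a b c))) ⟩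
      scaledSum (-K k') (composedBelow r (node ss) ys)    ≡⟨ sym (⊖-scaledSum k' _) ⟩
      ⊖ scaledSum k' (composedBelow r (node ss) ys)      ∎

  ▷-preLie-trees : ∀ p q w → associator [ p ] [ q ] [ w ] ≈L associator [ q ] [ p ] [ w ]
  ▷-preLie-trees (a , r) (b , s) (c , node ys) = begin
    associator [ (a , r) ] [ (b , s) ] [ (c , node ys) ]
      ≈⟨ associator-trees a r b s c ys ⟩
    scaledSum (a *K (b *K c)) (pairBelow r s ys)
      ≈⟨ PermUpTo⇒≈L (λ w → (a *K (b *K c) , node w)) (λ ws≋ws' → ≈tree (node≅ ws≋ws')) (pairBelow-comm r s ys) ⟩
    scaledSum (a *K (b *K c)) (pairBelow s r ys)
      ≈⟨ scaledSum-cong (pairBelow s r ys) (x∙yz≈y∙xz a b c) ⟩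
    scaledSum (b *K (a *K c)) (pairBelow s r ys)
      ≈⟨ ≈sym (associator-trees b s a r c ys) ⟩
    associator [ (b , s) ] [ (a , r) ] [ (c , node ys) ]
      ∎
    where open ≈L-Reasoning

  ▷-preLie : ∀ x y z → associator x y z ≈L associator y x z
  ▷-preLie = ≈L-by-singletons₃ associator-additive₃ (Additive₃-swap associator-additive₃) ▷-preLie-trees
    where
    associator-additive₃ : Additive₃ associator
    associator-additive₃ = record
      { additive₁ = λ y z → ⊖-additive (▷-additiveˡ (y ▷ z)) (∘-additive (▷-additiveˡ y) (▷-additiveˡ z))
      ; additive₂ = λ x z → ⊖-additive (∘-additive (▷-additiveˡ z) (▷-additiveʳ x))
                                       (∘-additive (▷-additiveʳ x) (▷-additiveˡ z))
      ; additive₃ = λ x y → ⊖-additive (∘-additive (▷-additiveʳ y) (▷-additiveʳ x)) (▷-additiveʳ (x ▷ y))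
      }

  ▷-⋎-derivation-trees : ∀ p q w → [ p ] ▷ ([ q ] ⋎ [ w ]) ≈L (([ p ] ▷ [ q ]) ⋎ [ w ]) ⊕ (([ p ] ▷ [ w ]) ⋎ [ q ])
  ▷-⋎-derivation-trees (a , r) (b , node ss) (c , node ts) = begin
    [ (a , r) ] ▷ [ (b *K c , node (ts ++ ss)) ]
      ≡⟨ ▷-trees a r (b *K c) (ts ++ ss) ⟩
    scaledSum k (graftBelow r (ts ++ ss))
      ≡⟨ cong (scaledSum k) (graftBelow-++ r ts ss) ⟩
    scaledSum k (map (_++ ss) (graftBelow r ts) ++ map (ts ++_) (graftBelow r ss))
      ≡⟨ map-++ _ (map (_++ ss) (graftBelow r ts)) _ ⟩
    scaledSum k (map (_++ ss) (graftBelow r ts)) ++ scaledSum k (map (ts ++_) (graftBelow r ss))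
      ≈⟨ ≈swap {x = scaledSum k (map (_++ ss) (graftBelow r ts))} ⟩
    scaledSum k (map (ts ++_) (graftBelow r ss)) ++ scaledSum k (map (_++ ss) (graftBelow r ts))
      ≈⟨ ≈++ in-t in-s ⟩
    (([ (a , r) ] ▷ [ (b , node ss) ]) ⋎ [ (c , node ts) ]) ⊕ (([ (a , r) ] ▷ [ (c , node ts) ]) ⋎ [ (b , node ss) ])
      ∎
    where
    open ≈L-Reasoning
    k : Carrier
    k = a *K (b *K c)
    in-t : scaledSum k (map (ts ++_) (graftBelow r ss)) ≈L ([ (a , r) ] ▷ [ (b , node ss) ]) ⋎ [ (c , node ts) ]
    in-t = begin
      scaledSum k (map (ts ++_) (graftBelow r ss))
        ≡⟨ sym (map-∘ (graftBelow r ss)) ⟩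
      map (λ w → (k , node (ts ++ w))) (graftBelow r ss)
        ≈⟨ map-≈L _ _ (λ _ → ≈coeff (≈K-sym (*-assoc a b c))) (graftBelow r ss) ⟩
      map (λ w → ((a *K b) *K c , node (ts ++ w))) (graftBelow r ss)
        ≡⟨ sym (trans (cong (_⋎ [ (c , node ts) ]) (▷-trees a r b ss)) (⋎-scaledSumˡ (a *K b) (graftBelow r ss) c ts)) ⟩
      ([ (a , r) ] ▷ [ (b , node ss) ]) ⋎ [ (c , node ts) ]
        ∎
    in-s : scaledSum k (map (_++ ss) (graftBelow r ts)) ≈L ([ (a , r) ] ▷ [ (c , node ts) ]) ⋎ [ (b , node ss) ]
    in-s = begin
      scaledSum k (map (_++ ss) (graftBelow r ts))
        ≡⟨ sym (map-∘ (graftBelow r ts)) ⟩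
      map (λ w → (k , node (w ++ ss))) (graftBelow r ts)
        ≈⟨ map-≈L _ _ (λ w → ≈L-term (x∙yz≈xz∙y a b c) (node≅ (↭⇒≋ (w ++ ss) (++-comm w ss)))) (graftBelow r ts) ⟩
      map (λ w → ((a *K c) *K b , node (ss ++ w))) (graftBelow r ts)
        ≡⟨ sym (trans (cong (_⋎ [ (b , node ss) ]) (▷-trees a r c ts)) (⋎-scaledSumˡ (a *K c) (graftBelow r ts) b ss)) ⟩
      ([ (a , r) ] ▷ [ (c , node ts) ]) ⋎ [ (b , node ss) ]
        ∎

  ▷-⋎-derivation : ∀ x y z → x ▷ (y ⋎ z) ≈L ((x ▷ y) ⋎ z) ⊕ ((x ▷ z) ⋎ y)
  ▷-⋎-derivation = ≈L-by-singletons₃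
    (record { additive₁ = λ y z → ▷-additiveˡ (y ⋎ z)
            ; additive₂ = λ x z → ∘-additive (⋎-additiveˡ z) (▷-additiveʳ x)
            ; additive₃ = λ x y → ∘-additive (⋎-additiveʳ y) (▷-additiveʳ x) })
    (record { additive₁ = λ y z → ⊕-additive (∘-additive (▷-additiveˡ y) (⋎-additiveˡ z))
                                             (∘-additive (▷-additiveˡ z) (⋎-additiveˡ y))
            ; additive₂ = λ x z → ⊕-additive (∘-additive (▷-additiveʳ x) (⋎-additiveˡ z)) (⋎-additiveʳ (x ▷ z))
            ; additive₃ = λ x y → ⊕-additive (⋎-additiveʳ (x ▷ y)) (∘-additive (▷-additiveʳ x) (⋎-additiveˡ y)) })
    ▷-⋎-derivation-trees

mainTheorem4 : ∀ {c ℓ} (K : Field c ℓ) → CharacteristicZero K →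
    (D : Set) → D →
    let open Lin K D in
    ∀ x y z → InTCK x → InTCK y → InTCK z →
      ((x ⋎ y) ≈L (y ⋎ x))
      × (((x ⋎ y) ⋎ z) ≈L (x ⋎ (y ⋎ z)))
      × (((x ▷ (y ▷ z)) ⊖ ((x ▷ y) ▷ z)) ≈L ((y ▷ (x ▷ z)) ⊖ ((y ▷ x) ▷ z)))
      × ((x ▷ (y ⋎ z)) ≈L (((x ▷ y) ⋎ z) ⊕ ((x ▷ z) ⋎ y)))
mainTheorem4 K _ D _ x y z _ _ _ =
  ⋎-comm K D x y , ⋎-assoc K D x y z , ▷-preLie K D x y z , ▷-⋎-derivation K D x y z
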